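{- Let $S,T\subseteq\mathbb{F}_2^n$. If $S$ and $T$ are affinely equivalent, then $\mathrm{Cay}(\gamma_S)$ is isomorphic to $\mathrm{Cay}(\gamma_T)$.
   Context: The affine span $\mathrm{aff}(S)$ is the set of sums of an odd number of elements of $S$. $S$ and $T$ are affinely equivalent if there is a bijective affine map $A:\mathrm{aff}(S)\to\mathrm{aff}(T)$ (of the form linear map plus constant) with $A(S)=T$. $\gamma_S(a)=1$ if $a\neq0$ and $(a+S)\cap S\neq\emptyset$, else $0$. For $f:\mathbb{F}_2^n\to\mathbb{F}_2$, $\mathrm{Cay}(f)$ has vertex set $\mathbb{F}_2^n$ and edges $\{u,v\}$ with $f(u+v)=1$. -}

module Defs where

open import Data.Bool using (Bool; true; false; _xor_; _∧_; not)
open import Data.Nat using (ℕ; zero; suc)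
open import Data.Nat.Properties using ()
open import Data.Vec using (Vec; []; _∷_; zipWith; replicate; map)
open import Data.List using (List; []; _∷_; foldr; length; _++_)
open import Data.Bool.ListAction using (any)
import Data.List as L
open import Data.List.Relation.Unary.All using (All)
open import Data.Product using (Σ; ∃; _×_; _,_)
open import Relation.Binary.PropositionalEquality using (_≡_; setoid)
open import Relation.Nullary using (¬_)
open import Relation.Nullary.Decidable using (⌊_⌋)
open import Data.Vec.Properties using (≡-dec)
open import Data.Bool.Properties using (_≟_)
open import Function.Bundles using (Bijection; _⇔_)
open import Level using (0ℓ)

F2^ : ℕ → Set
F2^ n = Vec Bool n

_⊕_ : ∀ {n} → F2^ n → F2^ n → F2^ n
_⊕_ = zipWith _xor_

𝟎 : ∀ {n} → F2^ n
𝟎 = replicate _ false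

Subset : ℕ → Set
Subset n = F2^ n → Bool

_∈_ : ∀ {n} → F2^ n → Subset n → Set
x ∈ S = S x ≡ true

allVecs : (n : ℕ) → List (F2^ n)
allVecs zero = [] ∷ []
allVecs (suc n) = L.map (false ∷_) (allVecs n) ++ L.map (true ∷_) (allVecs n)

data Odd : ℕ → Set where
  odd-one : Odd 1
  odd-ss  : ∀ {m} → Odd m → Odd (suc (suc m))

sumList : ∀ {n} → List (F2^ n) → F2^ n
sumList = foldr _⊕_ 𝟎

-- affine span: sums of an odd number of elements of S
inAff : ∀ {n} → Subset n → F2^ n → Set
inAff S x = Σ (List (F2^ _)) λ xs →
  All (λ y → y ∈ S) xs × Odd (length xs) × sumList xs ≡ x

-- linear maps F₂ⁿ → F₂ⁿ (over F₂, linearity = additivity)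
IsLinear : ∀ {n} → (F2^ n → F2^ n) → Set
IsLinear L = ∀ x y → L (x ⊕ y) ≡ L x ⊕ L y

-- S and T affinely equivalent: there is an affine map A x = L x + c
-- which restricts to a bijection aff(S) → aff(T) with A(S) = T
AffinelyEquivalent : ∀ {n} → Subset n → Subset n → Set
AffinelyEquivalent {n} S T =
  Σ (F2^ n → F2^ n) λ L → Σ (F2^ n) λ c →
    let A = λ x → L x ⊕ c in
    IsLinear L
    × (∀ x → inAff S x → inAff T (A x))
    × (∀ x y → inAff S x → inAff S y → A x ≡ A y → x ≡ y)
    × (∀ z → inAff T z → Σ (F2^ n) λ x → inAff S x × A x ≡ z)
    × (∀ x → x ∈ S → A x ∈ T)
    × (∀ z → z ∈ T → Σ (F2^ n) λ x → x ∈ S × A x ≡ z)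

γ : ∀ {n} → Subset n → F2^ n → Bool
γ {n} S a = not ⌊ ≡-dec _≟_ a 𝟎 ⌋ ∧ any (λ s → S s ∧ S (a ⊕ s)) (allVecs n)

CayAdj : ∀ {n} → (F2^ n → Bool) → F2^ n → F2^ n → Set
CayAdj f u v = f (u ⊕ v) ≡ true

CayIso : ∀ {n} → (F2^ n → Bool) → (F2^ n → Bool) → Set
CayIso {n} f g = Σ (Bijection (setoid (F2^ n)) (setoid (F2^ n))) λ φ →
  ∀ u v → CayAdj f u v ⇔ CayAdj g (Bijection.to φ u) (Bijection.to φ v)

{-# OPTIONS --safe #-}
-- γ_S is the indicator of the nonzero differences s + s′ of points of S, and all of these lie
-- in the subspace D of even sums of points of S.  If A x = L x + c is injective on aff(S), then
-- L is injective on D, because an even sum is a point of S plus an odd sum and both lie in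
-- aff(S).  So L restricted to D extends to a linear automorphism M of F₂ⁿ: grow the graph of a
-- partial linear bijection one vector at a time, the pigeonhole principle guaranteeing that its
-- codomain cannot fill up before its domain does.  As T = A(S) and A s + A s′ = L (s + s′), M maps
-- the differences of S onto those of T; thus γ_T ∘ M = γ_S, and a linear bijection carrying one
-- connection set onto the other is an isomorphism of the Cayley graphs.
module Submission where

open import Defs
open import Data.Bool using (Bool; true; false)
open import Data.Bool.Properties
  using (_≟_; xor-assoc; xor-comm; xor-same; xor-identityˡ; xor-identityʳ; T-≡; T-∧)
open import Data.Empty using (⊥-elim)
open import Data.Fin using (Fin; punchOut)
import Data.Fin.Properties as Fin
open import Data.List using (List; []; _∷_; _++_; length; filter; cartesianProductWith)
open import Data.List.Membership.Propositional using (lose) renaming (_∈_ to _∈ₗ_)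
open import Data.List.Membership.Propositional.Properties
  using (∈-map⁺; ∈-++⁺ˡ; ∈-++⁺ʳ; ∈-filter⁺; ∈-filter⁻; ∈-cartesianProductWith⁺; ∈-cartesianProductWith⁻)
open import Data.List.Properties using (length-++)
open import Data.List.Relation.Unary.All as All using (All; []; _∷_)
open import Data.List.Relation.Unary.All.Properties using (++⁺)
open import Data.List.Relation.Unary.Any using (here; satisfied; any?)
open import Data.List.Relation.Unary.Any.Properties using (any⁺; any⁻)
open import Data.Nat using (ℕ; zero; suc; _+_; _^_)
open import Data.Nat.Properties using (1+n≰n)
open import Data.Product using (Σ; ∃; _×_; _,_; proj₁; proj₂)
open import Data.Product.Function.NonDependent.Propositional using (_×-⇔_)
open import Data.Sum using (_⊎_; inj₁; inj₂)
open import Data.Unit using (⊤)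
open import Data.Vec using ([]; _∷_)
open import Data.Vec.Properties using (≡-dec; zipWith-assoc; zipWith-comm; zipWith-identityˡ; zipWith-identityʳ)
open import Data.Vec.Recursive using (lift↔; Fin[m^n]↔Fin[m]^n)
open import Data.Vec.Recursive.Properties using (↔Vec)
open import Function using (_∘_; id)
open import Function.Bundles using (Inverse; Injection; _↔_; _⇔_; mk⇔; mk⤖; Equivalence)
open import Function.Consequences.Propositional using (strictlySurjective⇒surjective)
open import Function.Definitions using (Injective; Surjective; StrictlySurjective; Bijective)
import Function.Properties.Equivalence as ⇔
open import Function.Properties.Inverse using (↔-trans; ↔-sym; ↔⇒↣)
open import Relation.Binary.Core using (_⇒_)
open import Relation.Binary.PropositionalEquality
open import Relation.Nullary using (¬_; Dec; yes; no; _×-dec_; _⊎-dec_; ¬?)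
open import Relation.Nullary.Decidable using (map′; decidable-stable; toWitnessFalse; fromWitnessFalse)
open import Relation.Unary using (Decidable)

open ≡-Reasoning

-- The Boolean group F₂ⁿ

⊕-self : ∀ {n} (a : F2^ n) → a ⊕ a ≡ 𝟎
⊕-self []      = refl
⊕-self (x ∷ a) = cong₂ _∷_ (xor-same x) (⊕-self a)

module _ {n : ℕ} where

  ⊕-assoc : (a b c : F2^ n) → (a ⊕ b) ⊕ c ≡ a ⊕ (b ⊕ c)
  ⊕-assoc = zipWith-assoc xor-assoc

  ⊕-comm : (a b : F2^ n) → a ⊕ b ≡ b ⊕ a
  ⊕-comm = zipWith-comm xor-comm

  ⊕-identityˡ : (a : F2^ n) → 𝟎 ⊕ a ≡ a
  ⊕-identityˡ = zipWith-identityˡ xor-identityˡ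

  ⊕-identityʳ : (a : F2^ n) → a ⊕ 𝟎 ≡ a
  ⊕-identityʳ = zipWith-identityʳ xor-identityʳ

  ⊕-cancelʳ : (a b : F2^ n) → (a ⊕ b) ⊕ b ≡ a
  ⊕-cancelʳ a b = begin
    (a ⊕ b) ⊕ b  ≡⟨ ⊕-assoc a b b ⟩
    a ⊕ (b ⊕ b)  ≡⟨ cong (a ⊕_) (⊕-self b) ⟩
    a ⊕ 𝟎        ≡⟨ ⊕-identityʳ a ⟩
    a            ∎

  ⊕-interchange : (a b c d : F2^ n) → (a ⊕ b) ⊕ (c ⊕ d) ≡ (a ⊕ c) ⊕ (b ⊕ d)
  ⊕-interchange a b c d = begin
    (a ⊕ b) ⊕ (c ⊕ d)  ≡⟨ ⊕-assoc a b (c ⊕ d) ⟩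
    a ⊕ (b ⊕ (c ⊕ d))  ≡⟨ cong (a ⊕_) (sym (⊕-assoc b c d)) ⟩
    a ⊕ ((b ⊕ c) ⊕ d)  ≡⟨ cong (λ z → a ⊕ (z ⊕ d)) (⊕-comm b c) ⟩
    a ⊕ ((c ⊕ b) ⊕ d)  ≡⟨ cong (a ⊕_) (⊕-assoc c b d) ⟩
    a ⊕ (c ⊕ (b ⊕ d))  ≡⟨ sym (⊕-assoc a c (b ⊕ d)) ⟩
    (a ⊕ c) ⊕ (b ⊕ d)  ∎

  ⊕-cancel-common : (a b c : F2^ n) → (a ⊕ c) ⊕ (b ⊕ c) ≡ a ⊕ b
  ⊕-cancel-common a b c = begin
    (a ⊕ c) ⊕ (b ⊕ c)  ≡⟨ ⊕-interchange a c b c ⟩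
    (a ⊕ b) ⊕ (c ⊕ c)  ≡⟨ cong ((a ⊕ b) ⊕_) (⊕-self c) ⟩
    (a ⊕ b) ⊕ 𝟎        ≡⟨ ⊕-identityʳ (a ⊕ b) ⟩
    a ⊕ b              ∎

  ⊕≡𝟎⇒≡ : {a b : F2^ n} → a ⊕ b ≡ 𝟎 → a ≡ b
  ⊕≡𝟎⇒≡ {a} {b} a⊕b≡𝟎 = begin
    a            ≡⟨ ⊕-cancelʳ a b ⟨
    (a ⊕ b) ⊕ b  ≡⟨ cong (_⊕ b) a⊕b≡𝟎 ⟩
    𝟎 ⊕ b        ≡⟨ ⊕-identityˡ b ⟩
    b            ∎

  linear-𝟎 : {L : F2^ n → F2^ n} → IsLinear L → L 𝟎 ≡ 𝟎
  linear-𝟎 {L} L-linear = begin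
    L 𝟎            ≡⟨ cong L (⊕-self 𝟎) ⟨
    L (𝟎 ⊕ 𝟎)      ≡⟨ L-linear 𝟎 𝟎 ⟩
    L 𝟎 ⊕ L 𝟎      ≡⟨ ⊕-self (L 𝟎) ⟩
    𝟎              ∎

-- Exhaustive search and the pigeonhole principle on F₂ⁿ

allVecs-complete : ∀ {n} (x : F2^ n) → x ∈ₗ allVecs n
allVecs-complete []                  = here refl
allVecs-complete {suc n} (false ∷ x) = ∈-++⁺ˡ (∈-map⁺ (false ∷_) (allVecs-complete x))
allVecs-complete {suc n} (true ∷ x)  =
  ∈-++⁺ʳ (Data.List.map (false ∷_) (allVecs n)) (∈-map⁺ (true ∷_) (allVecs-complete x))

∃? : ∀ {n} {P : F2^ n → Set} → Decidable P → Dec (∃ P)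
∃? {n} P? = map′ satisfied (λ (x , px) → lose (allVecs-complete x) px) (any? P? (allVecs n))

Fin-injective⇒surjective : ∀ {m} {f : Fin m → Fin m} → Injective _≡_ _≡_ f → StrictlySurjective _≡_ f
Fin-injective⇒surjective {suc m} {f} f-injective y with Fin.any? (λ i → f i Fin.≟ y)
... | yes found = found
... | no  f≢y   = ⊥-elim (1+n≰n (Fin.injective⇒≤ f-avoiding-y-injective))
  where
  y≢f : ∀ i → y ≢ f i
  y≢f i y≡fi = f≢y (i , sym y≡fi)

  f-avoiding-y : Fin (suc m) → Fin m
  f-avoiding-y i = punchOut (y≢f i)

  f-avoiding-y-injective : Injective _≡_ _≡_ f-avoiding-y
  f-avoiding-y-injective {i} {j} = f-injective ∘ Fin.punchOut-injective (y≢f i) (y≢f j)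

↔Fin-injective⇒surjective : ∀ {A : Set} {m} → A ↔ Fin m →
  {f : A → A} → Injective _≡_ _≡_ f → StrictlySurjective _≡_ f
↔Fin-injective⇒surjective A↔Fin {f} f-injective y =
  let i , f̂i≡ŷ = Fin-injective⇒surjective f̂-injective (to y) in
  from i , (begin
    f (from i)   ≡⟨ strictlyInverseʳ (f (from i)) ⟨
    from (f̂ i)   ≡⟨ cong from f̂i≡ŷ ⟩
    from (to y)  ≡⟨ strictlyInverseʳ y ⟩
    y            ∎)
  where
  open Inverse A↔Fin

  f̂ : Fin _ → Fin _
  f̂ = to ∘ f ∘ from

  f̂-injective : Injective _≡_ _≡_ f̂
  f̂-injective = Injection.injective (↔⇒↣ (↔-sym A↔Fin))
              ∘ f-injective
              ∘ Injection.injective (↔⇒↣ A↔Fin)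

F2^↔Fin : ∀ n → F2^ n ↔ Fin (2 ^ n)
F2^↔Fin n = ↔-sym (↔-trans (Fin[m^n]↔Fin[m]^n 2 n) (↔-trans (lift↔ n Fin.2↔Bool) (↔Vec n)))

-- Partial linear isomorphisms and their extension to automorphisms

module _ {n : ℕ} where

  Dom : (F2^ n → F2^ n → Set) → F2^ n → Set
  Dom G x = ∃ (G x)

  Cod : (F2^ n → F2^ n → Set) → F2^ n → Set
  Cod G y = ∃ λ x → G x y

  Dom-mono : ∀ {G G′} → G ⇒ G′ → ∀ {x} → Dom G x → Dom G′ x
  Dom-mono G⊆G′ (y , g) = y , G⊆G′ g

  -- A subspace of F₂ⁿ × F₂ⁿ meeting both axes trivially: the graph of a
  -- linear bijection between two subspaces of F₂ⁿ.
  record IsPartialIso (G : F2^ n → F2^ n → Set) : Set where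
    field
      decidable     : ∀ a b → Dec (G a b)
      𝟎∈            : G 𝟎 𝟎
      ⊕-closed      : ∀ {a b a′ b′} → G a b → G a′ b′ → G (a ⊕ a′) (b ⊕ b′)
      𝟎-functional  : ∀ {b} → G 𝟎 b → b ≡ 𝟎
      𝟎-injective   : ∀ {a} → G a 𝟎 → a ≡ 𝟎

    functional : ∀ {a b b′} → G a b → G a b′ → b ≡ b′
    functional g g′ = ⊕≡𝟎⇒≡ (𝟎-functional (subst (λ u → G u _) (⊕-self _) (⊕-closed g g′)))

    injective : ∀ {a a′ b} → G a b → G a′ b → a ≡ a′
    injective g g′ = ⊕≡𝟎⇒≡ (𝟎-injective (subst (G _) (⊕-self _) (⊕-closed g g′)))

    Dom? : ∀ x → Dec (Dom G x)
    Dom? x = ∃? (decidable x)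

    Cod? : ∀ y → Dec (Cod G y)
    Cod? y = ∃? (λ x → decidable x y)

  zeroGraph : F2^ n → F2^ n → Set
  zeroGraph a b = a ≡ 𝟎 × b ≡ 𝟎

  zeroGraph-isPartialIso : IsPartialIso zeroGraph
  zeroGraph-isPartialIso = record
    { decidable    = λ a b → ≡-dec _≟_ a 𝟎 ×-dec ≡-dec _≟_ b 𝟎
    ; 𝟎∈           = refl , refl
    ; ⊕-closed     = λ { (refl , refl) (refl , refl) → ⊕-self 𝟎 , ⊕-self 𝟎 }
    ; 𝟎-functional = proj₂
    ; 𝟎-injective  = proj₁
    }

  extend : (F2^ n → F2^ n → Set) → F2^ n → F2^ n → F2^ n → F2^ n → Set
  extend G x y a b = G a b ⊎ G (a ⊕ x) (b ⊕ y)

  module _ {G} (G-iso : IsPartialIso G) where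
    open IsPartialIso G-iso

    extend-∋ : ∀ {x y} → extend G x y x y
    extend-∋ {x} {y} = inj₂ (subst₂ G (sym (⊕-self x)) (sym (⊕-self y)) 𝟎∈)

    extend-isPartialIso : ∀ {x y} → ¬ Dom G x → ¬ Cod G y → IsPartialIso (extend G x y)
    extend-isPartialIso {x} {y} x∉Dom y∉Cod = record
      { decidable    = λ a b → decidable a b ⊎-dec decidable (a ⊕ x) (b ⊕ y)
      ; 𝟎∈           = inj₁ 𝟎∈
      ; ⊕-closed     = closed
      ; 𝟎-functional = λ { (inj₁ g) → 𝟎-functional g
                        ; (inj₂ g) → ⊥-elim (x∉Dom (_ , subst (λ u → G u _) (⊕-identityˡ x) g)) }
      ; 𝟎-injective  = λ { (inj₁ g) → 𝟎-injective g
                        ; (inj₂ g) → ⊥-elim (y∉Cod (_ , subst (G _) (⊕-identityˡ y) g)) }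
      }
      where
      shifted : ∀ {a b a′ b′} → G a b → G (a′ ⊕ x) (b′ ⊕ y) → G ((a ⊕ a′) ⊕ x) ((b ⊕ b′) ⊕ y)
      shifted {a} {b} {a′} {b′} g g′ =
        subst₂ G (sym (⊕-assoc a a′ x)) (sym (⊕-assoc b b′ y)) (⊕-closed g g′)

      closed : ∀ {a b a′ b′} → extend G x y a b → extend G x y a′ b′ → extend G x y (a ⊕ a′) (b ⊕ b′)
      closed (inj₁ g) (inj₁ g′) = inj₁ (⊕-closed g g′)
      closed (inj₁ g) (inj₂ g′) = inj₂ (shifted g g′)
      closed {a} {b} {a′} {b′} (inj₂ g) (inj₁ g′) =
        inj₂ (subst₂ (λ u v → G (u ⊕ x) (v ⊕ y)) (⊕-comm a′ a) (⊕-comm b′ b) (shifted g′ g))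
      closed {a} {b} {a′} {b′} (inj₂ g) (inj₂ g′) =
        inj₁ (subst₂ G (⊕-cancel-common a a′ x) (⊕-cancel-common b b′ y) (⊕-closed g g′))

  module _ (R : F2^ n → F2^ n → Set) where

    ExtendableAt : F2^ n → Set₁
    ExtendableAt x = ∀ {G} → IsPartialIso G → G ⇒ R → ¬ Dom G x →
                     ∃ λ y → ¬ Cod G y × extend G x y ⇒ R

    Extension : (F2^ n → F2^ n → Set) → ((F2^ n → F2^ n → Set) → Set) → Set₁
    Extension G P = ∃ λ G′ → IsPartialIso G′ × G′ ⇒ R × G ⇒ G′ × P G′

    cover : ∀ {x} → ExtendableAt x → ∀ {G} → IsPartialIso G → G ⇒ R →
            Extension G (λ G′ → Dom G′ x)
    cover {x} extendable {G} G-iso G⊆R with IsPartialIso.Dom? G-iso x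
    ... | yes x∈Dom = G , G-iso , G⊆R , id , x∈Dom
    ... | no  x∉Dom =
      let y , y∉Cod , extension⊆R = extendable G-iso G⊆R x∉Dom in
      extend G x y , extend-isPartialIso G-iso x∉Dom y∉Cod , extension⊆R , inj₁ , y , extend-∋ G-iso

    saturate : ∀ {xs} → All ExtendableAt xs → ∀ {G} → IsPartialIso G → G ⇒ R →
               Extension G (λ G′ → All (Dom G′) xs)
    saturate []                         G-iso G⊆R = _ , G-iso , G⊆R , id , []
    saturate (extendable ∷ extendables) G-iso G⊆R =
      let G₁ , G₁-iso , G₁⊆R , G⊆G₁ , x∈G₁  = cover extendable G-iso G⊆R
          G₂ , G₂-iso , G₂⊆R , G₁⊆G₂ , xs∈G₂ = saturate extendables G₁-iso G₁⊆R
      in G₂ , G₂-iso , G₂⊆R , (λ g → G₁⊆G₂ (G⊆G₁ g)) , Dom-mono {G₁} {G₂} G₁⊆G₂ x∈G₁ ∷ xs∈G₂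

  -- Were Cod G everything, G⁻¹ would be an injective self-map of F₂ⁿ missing x.
  ∃∉Cod : ∀ {G} → IsPartialIso G → ∀ {x} → ¬ Dom G x → ∃ λ y → ¬ Cod G y
  ∃∉Cod {G} G-iso {x} x∉Dom with ∃? (¬? ∘ IsPartialIso.Cod? G-iso)
  ... | yes y∉Cod  = y∉Cod
  ... | no  Cod-full =
    let y , preimage-y≡x = ↔Fin-injective⇒surjective (F2^↔Fin n) preimage-injective x in
    ⊥-elim (x∉Dom (y , subst (λ u → G u y) preimage-y≡x (proj₂ (inCod y))))
    where
    open IsPartialIso G-iso

    inCod : ∀ y → Cod G y
    inCod y = decidable-stable (Cod? y) (λ y∉Cod → Cod-full (y , y∉Cod))

    preimage : F2^ n → F2^ n
    preimage y = proj₁ (inCod y)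

    preimage-injective : Injective _≡_ _≡_ preimage
    preimage-injective {y} {y′} same =
      functional (proj₂ (inCod y)) (subst (λ u → G u y′) (sym same) (proj₂ (inCod y′)))

  total-extension : ∀ {G} → IsPartialIso G →
                    ∃ λ G′ → IsPartialIso G′ × G ⇒ G′ × (∀ x → Dom G′ x)
  total-extension G-iso =
    let G′ , G′-iso , _ , G⊆G′ , inDom = saturate (λ _ _ → ⊤) (All.universal extendable (allVecs n)) G-iso _
    in G′ , G′-iso , G⊆G′ , λ x → All.lookup inDom (allVecs-complete x)
    where
    extendable : ∀ x → ExtendableAt (λ _ _ → ⊤) x
    extendable x G-iso _ x∉Dom = let y , y∉Cod = ∃∉Cod G-iso x∉Dom in y , y∉Cod , _

  total⇒automorphism : ∀ {G} → IsPartialIso G → (∀ x → Dom G x) →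
    ∃ λ M → IsLinear M × Bijective _≡_ _≡_ M × G ⇒ (λ x y → M x ≡ y)
  total⇒automorphism {G} G-iso inDom =
    M , M-linear , (M-injective , M-surjective) , functional (on-graph _)
    where
    open IsPartialIso G-iso

    M : F2^ n → F2^ n
    M x = proj₁ (inDom x)

    on-graph : ∀ x → G x (M x)
    on-graph x = proj₂ (inDom x)

    M-linear : IsLinear M
    M-linear a b = functional (on-graph (a ⊕ b)) (⊕-closed (on-graph a) (on-graph b))

    M-injective : Injective _≡_ _≡_ M
    M-injective {a} {b} Ma≡Mb = injective (on-graph a) (subst (G b) (sym Ma≡Mb) (on-graph b))

    M-surjective : Surjective _≡_ _≡_ M
    M-surjective = strictlySurjective⇒surjective (↔Fin-injective⇒surjective (F2^↔Fin n) M-injective)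

  partialIso⇒automorphism : ∀ {G} → IsPartialIso G →
    ∃ λ M → IsLinear M × Bijective _≡_ _≡_ M × G ⇒ (λ x y → M x ≡ y)
  partialIso⇒automorphism G-iso =
    let G′ , G′-iso , G⊆G′ , inDom = total-extension G-iso
        M , M-linear , M-bijective , G′⊆M = total⇒automorphism G′-iso inDom
    in M , M-linear , M-bijective , λ g → G′⊆M (G⊆G′ g)

  record IsSubspace (E : F2^ n → Set) : Set where
    field
      𝟎∈       : E 𝟎
      ⊕-closed : ∀ {u v} → E u → E v → E (u ⊕ v)

  module _ {L : F2^ n → F2^ n} (L-linear : IsLinear L)
           {E : F2^ n → Set} (E-subspace : IsSubspace E)
           (L-injective-on-E : ∀ {w} → E w → L w ≡ 𝟎 → w ≡ 𝟎) where
    open IsSubspace E-subspace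

    graphOn : F2^ n → F2^ n → Set
    graphOn a b = E a × L a ≡ b

    extendable-by-L : ∀ {x} → E x → ExtendableAt graphOn x
    extendable-by-L {x} x∈E {G} G-iso G⊆graph x∉Dom = L x , Lx∉Cod , extension⊆graph
      where
      Lx∉Cod : ¬ Cod G (L x)
      Lx∉Cod (u , g) =
        let u∈E , Lu≡Lx = G⊆graph g
            u≡x = ⊕≡𝟎⇒≡ (L-injective-on-E (⊕-closed u∈E x∈E) (begin
              L (u ⊕ x)  ≡⟨ L-linear u x ⟩
              L u ⊕ L x  ≡⟨ cong (_⊕ L x) Lu≡Lx ⟩
              L x ⊕ L x  ≡⟨ ⊕-self (L x) ⟩
              𝟎          ∎))
        in x∉Dom (L x , subst (λ v → G v (L x)) u≡x g)

      extension⊆graph : extend G x (L x) ⇒ graphOn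
      extension⊆graph (inj₁ g) = G⊆graph g
      extension⊆graph {a} {b} (inj₂ g) =
        let a⊕x∈E , L[a⊕x]≡b⊕Lx = G⊆graph g in
        subst E (⊕-cancelʳ a x) (⊕-closed a⊕x∈E x∈E) , (begin
          L a              ≡⟨ cong L (⊕-cancelʳ a x) ⟨
          L ((a ⊕ x) ⊕ x)  ≡⟨ L-linear (a ⊕ x) x ⟩
          L (a ⊕ x) ⊕ L x  ≡⟨ cong (_⊕ L x) L[a⊕x]≡b⊕Lx ⟩
          (b ⊕ L x) ⊕ L x  ≡⟨ ⊕-cancelʳ b (L x) ⟩
          b                ∎)

    zeroGraph⊆graph : zeroGraph ⇒ graphOn
    zeroGraph⊆graph (refl , refl) = 𝟎∈ , linear-𝟎 L-linear

    record AgreeingAutomorphism (xs : List (F2^ n)) : Set where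
      field
        automorphism : F2^ n → F2^ n
        linear       : IsLinear automorphism
        bijective    : Bijective _≡_ _≡_ automorphism
        agrees       : All (λ x → automorphism x ≡ L x) xs

    automorphism-agreeing : ∀ {xs} → All E xs → AgreeingAutomorphism xs
    automorphism-agreeing xs∈E =
      let G , G-iso , G⊆graph , _ , inDom =
            saturate graphOn (All.map extendable-by-L xs∈E) zeroGraph-isPartialIso zeroGraph⊆graph
          M , M-linear , M-bijective , G⊆M = partialIso⇒automorphism G-iso
      in record
        { automorphism = M
        ; linear       = M-linear
        ; bijective    = M-bijective
        ; agrees       = All.map (λ (y , g) → trans (G⊆M g) (sym (proj₂ (G⊆graph g)))) inDom
        }

-- Even sums of points of S

data Even : ℕ → Set where
  even-zero : Even zero
  even-ss   : ∀ {m} → Even m → Even (suc (suc m))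

even-+ : ∀ {m k} → Even m → Even k → Even (m + k)
even-+ even-zero        k-even = k-even
even-+ (even-ss m-even) k-even = even-ss (even-+ m-even k-even)

even⇒odd-suc : ∀ {m} → Even m → Odd (suc m)
even⇒odd-suc even-zero        = odd-one
even⇒odd-suc (even-ss m-even) = odd-ss (even⇒odd-suc m-even)

even-suc⇒odd : ∀ {m} → Even (suc m) → Odd m
even-suc⇒odd (even-ss m-even) = even⇒odd-suc m-even

sumList-++ : ∀ {n} (xs ys : List (F2^ n)) → sumList (xs ++ ys) ≡ sumList xs ⊕ sumList ys
sumList-++ []       ys = sym (⊕-identityˡ (sumList ys))
sumList-++ (x ∷ xs) ys =
  trans (cong (x ⊕_) (sumList-++ xs ys)) (sym (⊕-assoc x (sumList xs) (sumList ys)))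

module _ {n : ℕ} (S : Subset n) where

  EvenSum : F2^ n → Set
  EvenSum w = Σ (List (F2^ n)) λ xs → All (_∈ S) xs × Even (length xs) × sumList xs ≡ w

  EvenSum-isSubspace : IsSubspace EvenSum
  EvenSum-isSubspace = record
    { 𝟎∈       = [] , [] , even-zero , refl
    ; ⊕-closed = λ { (xs , xs⊆S , xs-even , refl) (ys , ys⊆S , ys-even , refl) →
        xs ++ ys , ++⁺ xs⊆S ys⊆S , subst Even (sym (length-++ xs)) (even-+ xs-even ys-even) ,
        sumList-++ xs ys }
    }

  pair-evenSum : ∀ {s s′} → s ∈ S → s′ ∈ S → EvenSum (s ⊕ s′)
  pair-evenSum {s} {s′} s∈S s′∈S =
    s ∷ s′ ∷ [] , s∈S ∷ s′∈S ∷ [] , even-ss even-zero , cong (s ⊕_) (⊕-identityʳ s′)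

  evenSum-kernel : ∀ {L : F2^ n → F2^ n} {c} → IsLinear L →
    (∀ x y → inAff S x → inAff S y → L x ⊕ c ≡ L y ⊕ c → x ≡ y) →
    ∀ {w} → EvenSum w → L w ≡ 𝟎 → w ≡ 𝟎
  evenSum-kernel L-linear A-injective ([] , _ , _ , refl) _ = refl
  evenSum-kernel {L} {c} L-linear A-injective (s ∷ rest , s∈S ∷ rest⊆S , length-even , refl) Lw≡𝟎 =
    begin
      s ⊕ sumList rest               ≡⟨ cong (_⊕ sumList rest) s≡rest ⟩
      sumList rest ⊕ sumList rest    ≡⟨ ⊕-self (sumList rest) ⟩
      𝟎                              ∎
    where
    s≡rest : s ≡ sumList rest
    s≡rest = A-injective s (sumList rest)
      (s ∷ [] , s∈S ∷ [] , odd-one , ⊕-identityʳ s)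
      (rest , rest⊆S , even-suc⇒odd length-even , refl)
      (cong (_⊕ c) (⊕≡𝟎⇒≡ (trans (sym (L-linear s (sumList rest))) Lw≡𝟎)))

  _∈S? : Decidable (_∈ S)
  x ∈S? = S x ≟ true

  members : List (F2^ n)
  members = filter _∈S? (allVecs n)

  members⊆S : ∀ {x} → x ∈ₗ members → x ∈ S
  members⊆S = proj₂ ∘ ∈-filter⁻ _∈S? {xs = allVecs n}

  pairSums : List (F2^ n)
  pairSums = cartesianProductWith _⊕_ members members

  ∈-pairSums : ∀ {s s′} → s ∈ S → s′ ∈ S → (s ⊕ s′) ∈ₗ pairSums
  ∈-pairSums {s} {s′} s∈S s′∈S = ∈-cartesianProductWith⁺ _⊕_
    (∈-filter⁺ _∈S? (allVecs-complete s) s∈S) (∈-filter⁺ _∈S? (allVecs-complete s′) s′∈S)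

  pairSums-evenSum : All EvenSum pairSums
  pairSums-evenSum = All.tabulate evenSum-of-pairSum
    where
    evenSum-of-pairSum : ∀ {w} → w ∈ₗ pairSums → EvenSum w
    evenSum-of-pairSum w∈pairSums with ∈-cartesianProductWith⁻ _⊕_ members members w∈pairSums
    ... | s , s′ , s∈members , s′∈members , refl =
      pair-evenSum (members⊆S s∈members) (members⊆S s′∈members)

-- Connection sets and Cayley graphs

IsDifference : ∀ {n} → Subset n → F2^ n → Set
IsDifference S a = ∃ λ s → s ∈ S × (a ⊕ s) ∈ S

γ≡true⇔ : ∀ {n} (S : Subset n) a → γ S a ≡ true ⇔ (a ≢ 𝟎 × IsDifference S a)
γ≡true⇔ {n} S a = mk⇔ from-γ to-γ
  where
  open Equivalence using (to; from)

  from-γ : γ S a ≡ true → a ≢ 𝟎 × IsDifference S a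
  from-γ γ≡true =
    let a≢𝟎 , some-s   = to T-∧ (from T-≡ γ≡true)
        s , s∈S∧a⊕s∈S = satisfied (any⁻ _ (allVecs n) some-s)
        s∈S , a⊕s∈S   = to T-∧ s∈S∧a⊕s∈S
    in toWitnessFalse a≢𝟎 , s , to T-≡ s∈S , to T-≡ a⊕s∈S

  to-γ : a ≢ 𝟎 × IsDifference S a → γ S a ≡ true
  to-γ (a≢𝟎 , s , s∈S , a⊕s∈S) = to T-≡ (from T-∧ (fromWitnessFalse a≢𝟎 ,
    any⁺ _ (lose (allVecs-complete s) (from T-∧ (from T-≡ s∈S , from T-≡ a⊕s∈S)))))

module _ {n} {S T : Subset n} {A : F2^ n → F2^ n}
         (A[S]⊆T : ∀ x → x ∈ S → A x ∈ T)
         (T⊆A[S] : ∀ z → z ∈ T → Σ (F2^ n) λ x → x ∈ S × A x ≡ z)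
         {M : F2^ n → F2^ n} (M-linear : IsLinear M) (M-injective : Injective _≡_ _≡_ M)
         (M-on-differences : ∀ {s s′} → s ∈ S → s′ ∈ S → M (s ⊕ s′) ≡ A s ⊕ A s′) where

  ≢𝟎-transport : ∀ {a} → a ≢ 𝟎 ⇔ M a ≢ 𝟎
  ≢𝟎-transport = mk⇔
    (λ a≢𝟎 Ma≡𝟎 → a≢𝟎 (M-injective (trans Ma≡𝟎 (sym (linear-𝟎 M-linear)))))
    (λ Ma≢𝟎 a≡𝟎 → Ma≢𝟎 (trans (cong M a≡𝟎) (linear-𝟎 M-linear)))

  IsDifference-transport : ∀ {a} → IsDifference S a ⇔ IsDifference T (M a)
  IsDifference-transport {a} = mk⇔ forward backward
    where
    forward : IsDifference S a → IsDifference T (M a)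
    forward (s , s∈S , a⊕s∈S) =
      A s , A[S]⊆T s s∈S , subst (_∈ T) (sym Ma⊕As≡A[a⊕s]) (A[S]⊆T (a ⊕ s) a⊕s∈S)
      where
      Ma⊕As≡A[a⊕s] : M a ⊕ A s ≡ A (a ⊕ s)
      Ma⊕As≡A[a⊕s] = begin
        M a ⊕ A s                    ≡⟨ cong (λ u → M u ⊕ A s) (⊕-cancelʳ a s) ⟨
        M ((a ⊕ s) ⊕ s) ⊕ A s        ≡⟨ cong (_⊕ A s) (M-on-differences a⊕s∈S s∈S) ⟩
        (A (a ⊕ s) ⊕ A s) ⊕ A s      ≡⟨ ⊕-cancelʳ (A (a ⊕ s)) (A s) ⟩
        A (a ⊕ s)                    ∎

    backward : IsDifference T (M a) → IsDifference S a
    backward (t , t∈T , Ma⊕t∈T) =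
      let s  , s∈S  , As≡t     = T⊆A[S] t t∈T
          s′ , s′∈S , As′≡Ma⊕t = T⊆A[S] (M a ⊕ t) Ma⊕t∈T
          a≡s′⊕s = M-injective (begin
            M a                ≡⟨ ⊕-cancelʳ (M a) t ⟨
            (M a ⊕ t) ⊕ t      ≡⟨ cong₂ _⊕_ As′≡Ma⊕t As≡t ⟨
            A s′ ⊕ A s         ≡⟨ M-on-differences s′∈S s∈S ⟨
            M (s′ ⊕ s)         ∎)
      in s , s∈S , subst (_∈ S) (sym (trans (cong (_⊕ s) a≡s′⊕s) (⊕-cancelʳ s′ s))) s′∈S

  γ-transport : ∀ a → γ S a ≡ true ⇔ γ T (M a) ≡ true
  γ-transport a = ⇔.trans (γ≡true⇔ S a) (⇔.trans both (⇔.sym (γ≡true⇔ T (M a))))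
    where
    both : (a ≢ 𝟎 × IsDifference S a) ⇔ (M a ≢ 𝟎 × IsDifference T (M a))
    both = ≢𝟎-transport ×-⇔ IsDifference-transport

linear-bijection⇒CayIso : ∀ {n} {f g : F2^ n → Bool} {M : F2^ n → F2^ n} →
  IsLinear M → Bijective _≡_ _≡_ M → (∀ a → f a ≡ true ⇔ g (M a) ≡ true) → CayIso f g
linear-bijection⇒CayIso {f = f} {g} M-linear M-bijective f⇔g∘M =
  mk⤖ M-bijective , λ u v → subst (λ w → CayAdj f u v ⇔ g w ≡ true) (M-linear u v) (f⇔g∘M (u ⊕ v))

proposition4p2 : (n : ℕ) (S T : Subset n) →
    AffinelyEquivalent S T → CayIso (γ S) (γ T)
proposition4p2 n S T (L , c , L-linear , _ , A-injective , _ , A[S]⊆T , T⊆A[S]) =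
  linear-bijection⇒CayIso {f = γ S} {g = γ T} linear bijective
    (γ-transport A[S]⊆T T⊆A[S] linear (proj₁ bijective) on-differences)
  where
  open AgreeingAutomorphism
    (automorphism-agreeing L-linear (EvenSum-isSubspace S) (evenSum-kernel S L-linear A-injective)
                           (pairSums-evenSum S))

  on-differences : ∀ {s s′} → s ∈ S → s′ ∈ S → automorphism (s ⊕ s′) ≡ (L s ⊕ c) ⊕ (L s′ ⊕ c)
  on-differences {s} {s′} s∈S s′∈S = begin
    automorphism (s ⊕ s′)   ≡⟨ All.lookup agrees (∈-pairSums S s∈S s′∈S) ⟩
    L (s ⊕ s′)              ≡⟨ L-linear s s′ ⟩
    L s ⊕ L s′              ≡⟨ ⊕-cancel-common (L s) (L s′) c ⟨
    (L s ⊕ c) ⊕ (L s′ ⊕ c)  ∎
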